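{- Let $p$ be a prime and $n$ a positive integer. For a positive integer $t$, let $N(t)$ be the number of pairs $(x,y)$ of integers with $0<x\le t$ and $0<y\le t+1$ satisfying $\frac{x^2+x}{y}=t$. Then $N(p)=N(p^n)$. -}

module Defs where

open import Data.Nat using (ℕ; suc; _+_; _*_; _≟_)
open import Data.List using (List; length; filter; cartesianProduct; map)
open import Data.List.Base using (upTo)
open import Data.Product using (_×_; _,_)
open import Relation.Binary.PropositionalEquality using (_≡_)
open import Relation.Nullary using (Dec)

range1 : ℕ → List ℕ
range1 n = map suc (upTo n)

-- The condition (x² + x) / y = t, for y > 0, as an equation of integers:
-- x * x + x = t * y.
Sol : ℕ → ℕ × ℕ → Set
Sol t (x , y) = x * x + x ≡ t * y

sol? : (t : ℕ) → (p : ℕ × ℕ) → Dec (Sol t p)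
sol? t (x , y) = (x * x + x) ≟ (t * y)

N : ℕ → ℕ
N t = length (filter (sol? t) (cartesianProduct (range1 t) (range1 (suc t))))

{-# OPTIONS --safe #-}
module Submission where

-- For t > 1 such that t ∣ x(x+1) forces t ∣ x or t ∣ x+1 (every prime power: a prime cannot
-- divide two consecutive numbers), the solutions with 1 ≤ x ≤ t are exactly (t-1, t-1) and
-- (t, t+1): for x < t-1 neither x nor x+1 is a positive multiple of t, and y is determined by x.
-- So N(p^k) = 2 for every k ≥ 1.

open import Defs
open import Data.Nat using (ℕ; suc; _^_)
open import Data.Nat.Primality using (Prime)
open import Relation.Binary.PropositionalEquality using (_≡_)

open import Data.Nat.Base
  using (zero; _+_; _*_; _≤_; _<_; NonZero; s≤s; s≤s⁻¹; z<s; >-nonZero; nonTrivial⇒n>1; nonTrivial⇒≢1)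
open import Data.Nat.Properties
  using (_≟_; +-comm; *-comm; *-assoc; *-suc; *-identityʳ; *-cancelˡ-≡; m≤m*n; m^n≢0; ≤∧≢⇒<; <-≤-trans; m≤n⇒m≤1+n; 1+n≰n; ≤-refl; n≤1+n)
open import Data.Nat.Divisibility
  using (_∣_; _∤_; _∣?_; divides; 1∣_; ∣-trans; m∣m*n; ∣1⇒≡1; ∣m+n∣m⇒∣n; *-monoʳ-∣; *-cancelˡ-∣; >⇒∤)
open import Data.Nat.Primality using (euclidsLemma; prime⇒nonZero; prime⇒nonTrivial)
open import Data.List.Base using (List; []; _∷_; [_]; _++_; _∷ʳ_; length; filter; map; upTo; cartesianProduct)
open import Data.List.Properties using (length-++; filter-++; filter-none; filter-accept; filter-≐; map-++; upTo-∷ʳ; ++-assoc; ++-identityʳ; cartesianProductWith-distribʳ-++)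
open import Data.List.Relation.Unary.All as All using (All)
open import Data.List.Relation.Unary.All.Properties using (map⁺; applyUpTo⁺₁; cartesianProduct⁺)
open import Data.Product.Base using (_×_; _,_)
open import Data.Sum.Base using (_⊎_; inj₁; inj₂)
open import Function.Base using (_∘_; id)
open import Relation.Nullary using (yes; no; ¬_; contradiction)
open import Relation.Unary using (Pred; Decidable; ∁; _≐_)
open import Relation.Binary.PropositionalEquality using (refl; sym; trans; cong; cong₂; subst; setoid; module ≡-Reasoning)
open ≡-Reasoning

count : ∀ {a p} {A : Set a} {P : Pred A p} → Decidable P → List A → ℕ
count P? xs = length (filter P? xs)

module _ {a p} {A : Set a} {P : Pred A p} (P? : Decidable P) where

  count-++ : ∀ xs ys → count P? (xs ++ ys) ≡ count P? xs + count P? ys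
  count-++ xs ys = trans (cong length (filter-++ P? xs ys)) (length-++ (filter P? xs))

  count-none : ∀ {xs} → All (∁ P) xs → count P? xs ≡ 0
  count-none ¬Pxs = cong length (filter-none P? ¬Pxs)

  count-[x] : ∀ {x} → P x → count P? [ x ] ≡ 1
  count-[x] Px = cong length (filter-accept P? Px)

  count-map : ∀ {b} {B : Set b} (f : B → A) xs → count P? (map f xs) ≡ count (P? ∘ f) xs
  count-map f []       = refl
  count-map f (x ∷ xs) with P? (f x)
  ... | yes _ = cong suc (count-map f xs)
  ... | no _  = count-map f xs

count-cartesianProduct-++ : ∀ {a b p} {A : Set a} {B : Set b} {P : Pred (A × B) p} (P? : Decidable P) xs xs′ ys →
                            count P? (cartesianProduct (xs ++ xs′) ys) ≡
                            count P? (cartesianProduct xs ys) + count P? (cartesianProduct xs′ ys)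
count-cartesianProduct-++ P? xs xs′ ys =
  trans (cong (count P?) (cartesianProductWith-distribʳ-++ _,_ xs xs′ ys)) (count-++ P? (cartesianProduct xs ys) (cartesianProduct xs′ ys))

count-≐ : ∀ {a p q} {A : Set a} {P : Pred A p} {Q : Pred A q} (P? : Decidable P) (Q? : Decidable Q) →
          P ≐ Q → ∀ xs → count P? xs ≡ count Q? xs
count-≐ P? Q? P≐Q xs = cong length (filter-≐ P? Q? P≐Q xs)

range1-suc : ∀ m → range1 (suc m) ≡ range1 m ∷ʳ suc m
range1-suc m = begin
  map suc (upTo (suc m))   ≡⟨ cong (map suc) (sym (upTo-∷ʳ m)) ⟩
  map suc (upTo m ∷ʳ m)    ≡⟨ map-++ suc (upTo m) [ m ] ⟩
  range1 m ∷ʳ suc m        ∎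

range1-bounds : ∀ m → All (λ x → 0 < x × x ≤ m) (range1 m)
range1-bounds m = map⁺ (applyUpTo⁺₁ id m (λ i<m → z<s , i<m))

count-range1-suc : ∀ {p} {P : Pred ℕ p} (P? : Decidable P) m →
                   count P? (range1 (suc m)) ≡ count P? (range1 m) + count P? [ suc m ]
count-range1-suc P? m = trans (cong (count P?) (range1-suc m)) (count-++ P? (range1 m) [ suc m ])

count-≟-range1 : ∀ {a} m → 0 < a → a ≤ m → count (_≟ a) (range1 m) ≡ 1
count-≟-range1 zero    (s≤s _) ()
count-≟-range1 {a} (suc m) 0<a a≤1+m with a ≟ suc m
... | yes refl = trans (count-range1-suc (_≟ a) m)
  (cong₂ _+_ (count-none (_≟ a) (All.map (λ { (_ , x≤m) refl → 1+n≰n x≤m }) (range1-bounds m)))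
             (count-[x] (_≟ a) refl))
... | no a≢1+m = trans (count-range1-suc (_≟ a) m)
  (cong₂ _+_ (count-≟-range1 m 0<a (s≤s⁻¹ (≤∧≢⇒< a≤1+m a≢1+m)))
             (count-none (_≟ a) ((a≢1+m ∘ sym) All.∷ All.[])))

Sol⇒∣ : ∀ {t x y} → Sol t (x , y) → t ∣ x * suc x
Sol⇒∣ {t} {x} {y} sol = divides y (begin
  x * suc x    ≡⟨ *-suc x x ⟩
  x + x * x    ≡⟨ +-comm x (x * x) ⟩
  x * x + x    ≡⟨ sol ⟩
  t * y        ≡⟨ *-comm t y ⟩
  y * t        ∎)

Sol-[x,x] : ∀ x → Sol (suc x) (x , x)
Sol-[x,x] x = +-comm (x * x) x

Sol-[t,1+t] : ∀ t → Sol t (t , suc t)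
Sol-[t,1+t] t = trans (+-comm (t * t) t) (sym (*-suc t t))

Sol-functional : ∀ {t x y y′} .{{_ : NonZero t}} → Sol t (x , y) → Sol t (x , y′) → y ≡ y′
Sol-functional {t} {y = y} {y′} sol sol′ = *-cancelˡ-≡ y y′ t (trans (sym sol) sol′)

count-Sol-fibre : ∀ {t x y} m .{{_ : NonZero t}} → Sol t (x , y) → 0 < y → y ≤ m →
                  count (sol? t) (cartesianProduct [ x ] (range1 m)) ≡ 1
count-Sol-fibre {t} {x} {y} m sol 0<y y≤m = begin
  count (sol? t) (cartesianProduct [ x ] (range1 m))  ≡⟨ cong (count (sol? t)) (++-identityʳ (map (x ,_) (range1 m))) ⟩
  count (sol? t) (map (x ,_) (range1 m))              ≡⟨ count-map (sol? t) (x ,_) (range1 m) ⟩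
  count (sol? t ∘ (x ,_)) (range1 m)                  ≡⟨ count-≐ (sol? t ∘ (x ,_)) (_≟ y) Sol≐≡y (range1 m) ⟩
  count (_≟ y) (range1 m)                             ≡⟨ count-≟-range1 m 0<y y≤m ⟩
  1                                                   ∎
  where
  Sol≐≡y : (λ y′ → Sol t (x , y′)) ≐ (_≡ y)
  Sol≐≡y = (λ {y′} sol′ → Sol-functional {t} {x} {y′} {y} sol′ sol) , λ { refl → sol }

N≡2 : ∀ {t} → 1 < t → (∀ x → t ∣ x * suc x → t ∣ x ⊎ t ∣ suc x) → N t ≡ 2
N≡2 {t@(suc (suc u))} (s≤s (s≤s _)) split = begin
  N t
    ≡⟨ cong (λ xs → count (sol? t) (cartesianProduct xs ys)) range1-t ⟩
  count (sol? t) (cartesianProduct (range1 u ++ [ suc u ] ++ [ t ]) ys)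
    ≡⟨ count-cartesianProduct-++ (sol? t) (range1 u) _ ys ⟩
  count (sol? t) (cartesianProduct (range1 u) ys) + count (sol? t) (cartesianProduct ([ suc u ] ++ [ t ]) ys)
    ≡⟨ cong (count (sol? t) (cartesianProduct (range1 u) ys) +_) (count-cartesianProduct-++ (sol? t) [ suc u ] [ t ] ys) ⟩
  count (sol? t) (cartesianProduct (range1 u) ys) +
    (count (sol? t) (cartesianProduct [ suc u ] ys) + count (sol? t) (cartesianProduct [ t ] ys))
    ≡⟨ cong₂ _+_ no-small-solutions (cong₂ _+_ solution-[1+u,1+u] solution-[t,1+t]) ⟩
  2 ∎
  where
  ys : List ℕ
  ys = range1 (suc t)

  range1-t : range1 t ≡ range1 u ++ [ suc u ] ++ [ t ]
  range1-t = begin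
    range1 t                      ≡⟨ range1-suc (suc u) ⟩
    range1 (suc u) ∷ʳ t           ≡⟨ cong (_∷ʳ t) (range1-suc u) ⟩
    (range1 u ∷ʳ suc u) ∷ʳ t      ≡⟨ ++-assoc (range1 u) [ suc u ] [ t ] ⟩
    range1 u ++ [ suc u ] ++ [ t ] ∎

  no-small-solutions : count (sol? t) (cartesianProduct (range1 u) ys) ≡ 0
  no-small-solutions = count-none (sol? t)
    (cartesianProduct⁺ (setoid ℕ) (setoid ℕ) (range1 u) ys (λ {x} {y} x∈ _ → ¬Sol {x} {y} (All.lookup (range1-bounds u) x∈)))
    where
    ¬Sol : ∀ {x y} → 0 < x × x ≤ u → ¬ Sol t (x , y)
    ¬Sol {x} {y} (0<x , x≤u) sol with split x (Sol⇒∣ {t} {x} {y} sol)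
    ... | inj₁ t∣x   = >⇒∤ {{>-nonZero 0<x}} (s≤s (m≤n⇒m≤1+n x≤u)) t∣x
    ... | inj₂ t∣1+x = >⇒∤ (s≤s (s≤s x≤u)) t∣1+x

  solution-[1+u,1+u] : count (sol? t) (cartesianProduct [ suc u ] ys) ≡ 1
  solution-[1+u,1+u] = count-Sol-fibre {t} {suc u} {suc u} (suc t) (Sol-[x,x] (suc u)) z<s (m≤n⇒m≤1+n (n≤1+n (suc u)))

  solution-[t,1+t] : count (sol? t) (cartesianProduct [ t ] ys) ≡ 1
  solution-[t,1+t] = count-Sol-fibre {t} {t} {suc t} (suc t) (Sol-[t,1+t] t) z<s ≤-refl

∣n∧∣1+n⇒≡1 : ∀ {d n} → d ∣ n → d ∣ suc n → d ≡ 1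
∣n∧∣1+n⇒≡1 {d} {n} d∣n d∣1+n = ∣1⇒≡1 (∣m+n∣m⇒∣n (subst (d ∣_) (+-comm 1 n) d∣1+n) d∣n)

p^k∣m*n∧p∤n⇒p^k∣m : ∀ {p} → Prime p → ∀ k {m n} → p ∤ n → p ^ k ∣ m * n → p ^ k ∣ m
p^k∣m*n∧p∤n⇒p^k∣m     pp zero    {m}     _   _          = 1∣ m
p^k∣m*n∧p∤n⇒p^k∣m {p} pp (suc k) {m} {n} p∤n p^[1+k]∣mn
  with euclidsLemma m n pp (∣-trans (m∣m*n (p ^ k)) p^[1+k]∣mn)
... | inj₂ p∣n             = contradiction p∣n p∤n
... | inj₁ (divides m′ refl) = subst (p ^ suc k ∣_) (*-comm p m′) (*-monoʳ-∣ p p^k∣m′)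
  where
  p^k∣m′ : p ^ k ∣ m′
  p^k∣m′ = p^k∣m*n∧p∤n⇒p^k∣m pp k p∤n (*-cancelˡ-∣ p {{prime⇒nonZero pp}}
    (subst (p ^ suc k ∣_) (trans (cong (_* n) (*-comm m′ p)) (*-assoc p m′ n)) p^[1+k]∣mn))

p^k∣consecutive : ∀ {p} → Prime p → ∀ k x → p ^ k ∣ x * suc x → p ^ k ∣ x ⊎ p ^ k ∣ suc x
p^k∣consecutive {p} pp k x p^k∣x[1+x] with p ∣? x
... | yes p∣x = inj₁ (p^k∣m*n∧p∤n⇒p^k∣m pp k p∤1+x p^k∣x[1+x])
  where
  p∤1+x : p ∤ suc x
  p∤1+x p∣1+x = nonTrivial⇒≢1 {{prime⇒nonTrivial pp}} (∣n∧∣1+n⇒≡1 p∣x p∣1+x)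
... | no p∤x  = inj₂ (p^k∣m*n∧p∤n⇒p^k∣m pp k p∤x (subst (p ^ k ∣_) (*-comm x (suc x)) p^k∣x[1+x]))

1<p^[1+k] : ∀ {p} → Prime p → ∀ k → 1 < p ^ suc k
1<p^[1+k] {p} pp k = <-≤-trans (nonTrivial⇒n>1 p) (m≤m*n p (p ^ k) {{m^n≢0 p k}})
  where
  instance
    _ = prime⇒nonTrivial pp
    _ = prime⇒nonZero pp

N[p^[1+k]]≡2 : ∀ {p} → Prime p → ∀ k → N (p ^ suc k) ≡ 2
N[p^[1+k]]≡2 pp k = N≡2 (1<p^[1+k] pp k) (p^k∣consecutive pp (suc k))

lemma6p5 : (p : ℕ) → Prime p → (n : ℕ) → N p ≡ N (p ^ suc n)
lemma6p5 p pp n = begin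
  N p            ≡⟨ cong N (sym (*-identityʳ p)) ⟩
  N (p ^ 1)      ≡⟨ N[p^[1+k]]≡2 pp 0 ⟩
  2              ≡⟨ sym (N[p^[1+k]]≡2 pp n) ⟩
  N (p ^ suc n)  ∎
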